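{- Let $\Lambda$ be a symplectic lattice of type $(d_1,\dots,d_g)$ with $d_1=1$. Then for every $x\in D_\Lambda$ there exists a primitive vector $v\in\Lambda$ with $[v^\ast]=x$; i.e. the map from $\Gamma_\Lambda$-orbits of primitive vectors of $\Lambda$ to $D_\Lambda$ given by $v\mapsto[v^\ast]$ is surjective.
   Context: A symplectic lattice is a free $\mathbb{Z}$-module $\Lambda$ of rank $2g$ with a nondegenerate alternating bilinear form $(\cdot,\cdot)\colon\Lambda\times\Lambda\to\mathbb{Z}$. Let $U$ be the rank-2 lattice with Gram matrix $\begin{pmatrix}0&1\\-1&0\end{pmatrix}$ and $U(d)$ its form scaled by $d$. Every symplectic lattice is isometric to $U(d_1)\oplus\cdots\oplus U(d_g)$ with $d_i\mid d_{i+1}$; $(d_1,\dots,d_g)$ is its type. $\Lambda^\vee=\{v\in\Lambda\otimes\mathbb{Q}\mid (v,\Lambda)\subset\mathbb{Z}\}$, $D_\Lambda=\Lambda^\vee/\Lambda$. $\Gamma_\Lambda$ is the kernel of $\mathrm{Sp}(\Lambda)\to\mathrm{Sp}(D_\Lambda)$. A vector $v$ is primitive if $\mathbb{Q}v\cap\Lambda=\mathbb{Z}v$; then $\mathrm{div}(v)>0$ is defined by $(v,\Lambda)=\mathrm{div}(v)\mathbb{Z}$, $v^\ast=v/\mathrm{div}(v)$, and $[v^\ast]$ is its class in $D_\Lambda$. -}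

module Defs where

open import Data.Nat as ℕ using (ℕ; suc)
open import Data.Integer as ℤ using (ℤ; +_)
open import Data.Rational as ℚ using (ℚ; _/_)
open import Data.Fin using (Fin; zero; suc; inject₁)
open import Data.Product using (_×_; _,_; proj₁; proj₂; ∃; ∃-syntax)
open import Relation.Binary.PropositionalEquality using (_≡_)
open import Relation.Nullary using (¬_)
import Data.Nat.Divisibility as ℕD
import Data.Integer.Divisibility as ℤD

-- Standard model of a symplectic lattice of type (d_0,...,d_{g-1}):
-- Λ = ℤ^{2g} with basis e_i, f_i, (e_i,f_i) = d_i = -(f_i,e_i), all other pairings 0,
-- i.e. Λ = U(d_0) ⊕ ... ⊕ U(d_{g-1}).  A vector is given by its (e_i, f_i)-coordinates.
Lat : ℕ → Set
Lat g = Fin g → ℤ × ℤ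

LatQ : ℕ → Set
LatQ g = Fin g → ℚ × ℚ

sumℤ : ∀ {g} → (Fin g → ℤ) → ℤ
sumℤ {ℕ.zero} f = + 0
sumℤ {suc g} f = f zero ℤ.+ sumℤ (λ i → f (suc i))

sumℚ : ∀ {g} → (Fin g → ℚ) → ℚ
sumℚ {ℕ.zero} f = ℚ.0ℚ
sumℚ {suc g} f = f zero ℚ.+ sumℚ (λ i → f (suc i))

form : ∀ {g} → (Fin g → ℕ) → Lat g → Lat g → ℤ
form d x y = sumℤ (λ i → (+ d i) ℤ.* (proj₁ (x i) ℤ.* proj₂ (y i) ℤ.- proj₂ (x i) ℤ.* proj₁ (y i)))

formℚ : ∀ {g} → (Fin g → ℕ) → LatQ g → LatQ g → ℚ
formℚ d x y = sumℚ (λ i → ((+ d i) / 1) ℚ.* (proj₁ (x i) ℚ.* proj₂ (y i) ℚ.- proj₂ (x i) ℚ.* proj₁ (y i)))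

ιℤ : ℤ → ℚ
ιℤ k = k / 1

IsInt : ℚ → Set
IsInt q = ∃[ k ] q ≡ ιℤ k

embed : ∀ {g} → Lat g → LatQ g
embed v i = ιℤ (proj₁ (v i)) , ιℤ (proj₂ (v i))

InLat : ∀ {g} → LatQ g → Set
InLat y = ∀ i → IsInt (proj₁ (y i)) × IsInt (proj₂ (y i))

InDual : ∀ {g} → (Fin g → ℕ) → LatQ g → Set
InDual d y = ∀ (l : Lat _) → IsInt (formℚ d y (embed l))

scaleℚ : ∀ {g} → ℚ → LatQ g → LatQ g
scaleℚ q y i = q ℚ.* proj₁ (y i) , q ℚ.* proj₂ (y i)

subℚ : ∀ {g} → LatQ g → LatQ g → LatQ g
subℚ x y i = proj₁ (x i) ℚ.- proj₁ (y i) , proj₂ (x i) ℚ.- proj₂ (y i)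

zeroLat : ∀ {g} → Lat g
zeroLat i = + 0 , + 0

Primitive : ∀ {g} → Lat g → Set
Primitive v = ¬ (v ≡ zeroLat) × (∀ q → InLat (scaleℚ q (embed v)) → IsInt q)

-- div(v) = n  means  (v, Λ) = n ℤ
IsDiv : ∀ {g} → (Fin g → ℕ) → Lat g → ℕ → Set
IsDiv d v n = (∀ l → (+ n) ℤD.∣ form d v l) × (∃[ l ] form d v l ≡ + n)

-- [x] = [y] in D_Λ = Λ^∨ / Λ
SameClass : ∀ {g} → LatQ g → LatQ g → Set
SameClass x y = InLat (subℚ x y)

-- symplectic type (d_0,...,d_g) (rank 2(g+1)): all d_i > 0 and d_i ∣ d_{i+1}
IsType : ∀ {g} → (Fin (suc g) → ℕ) → Set
IsType {g} d = (∀ i → ℕ.NonZero (d i)) × (∀ (i : Fin g) → d (inject₁ i) ℕD.∣ d (suc i))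

-- v* = v / n  for n = suc k (= div(v))
vstar : ∀ {g} → Lat g → ℕ → LatQ g
vstar v k i = (proj₁ (v i) / suc k) , (proj₂ (v i) / suc k)

{-# OPTIONS --safe #-}
module Submission where

-- Since d₀ = 1, the U(d₀)-coordinates of x ∈ Λ^∨ are integral, so x ≡ y := (1,0) ∷ (x₁,…,x_g)
-- modulo Λ, and y ∈ Λ^∨ still (dᵢ yᵢ ∈ ℤ² for all i). Let N be the order of y in D_Λ (finite,
-- as (∏ dᵢ) y ∈ Λ) and v := N y ∈ Λ, so that v* = y. Each dᵢ vᵢ = N (dᵢ yᵢ) lies in N ℤ², so
-- N ∣ (v, Λ), and (v, f₀) = d₀ N = N: div v = N. If q v ∈ Λ, its first coordinate q N is an
-- integer r with r y ∈ Λ; the integers r with r y ∈ Λ are exactly N ℤ, so q ∈ ℤ and v is primitive.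

open import Defs
open import Data.Nat as ℕ using (ℕ; suc; _<_)
open import Data.Nat.Induction using (<-wellFounded)
open import Data.Nat.ListAction using (product)
open import Data.Nat.ListAction.Properties using (∈⇒∣product; product≢0)
import Data.Nat.Divisibility as ℕD
import Data.Nat.Properties as ℕP
open import Data.Nat.GCD using (gcd; gcd-zeroʳ)
open import Data.Integer as ℤ using (ℤ; +_)
import Data.Integer.Properties as ℤP
open import Data.Integer.DivMod using (_%ℕ_; _/ℕ_; a≡a%ℕn+[a/ℕn]*n; n%ℕd<d)
open import Data.Integer.Divisibility.Signed
  using (_∣_; divides; quotient; ∣⇒∣ᵤ; ∣m∣n⇒∣m+n; ∣m∣n⇒∣m-n; ∣m⇒∣m*n)
open import Data.Integer.Tactic.RingSolver using (solve-∀)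
open import Data.Rational as ℚ using (ℚ; _/_; ↥_)
import Data.Rational.Properties as ℚP
import Data.Rational.Unnormalised as ℚᵘ
import Data.Rational.Unnormalised.Properties as ℚᵘP
open import Data.Rational.Solver using (module +-*-Solver)
open import Data.Fin using (Fin; zero; suc)
import Data.Fin.Properties as FinP
open import Data.Vec.Functional using (_∷_; tail; updateAt)
open import Data.Vec.Functional.Properties using (updateAt-updates; updateAt-minimal)
open import Data.List using (tabulate)
open import Data.List.Membership.Propositional.Properties using (∈-tabulate⁺)
import Data.List.Relation.Unary.All.Properties as AllP
open import Data.Empty using (⊥-elim)
open import Data.Product using (_×_; _,_; proj₁; proj₂; ∃-syntax)
open import Function using (const; _∘_)
open import Induction.WellFounded using (Acc; acc)
open import Relation.Binary.PropositionalEquality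
open import Relation.Nullary using (¬_; Dec; yes; no)
open import Relation.Nullary.Decidable using (_×-dec_)
open import Relation.Unary using (Pred; Decidable)

open +-*-Solver using (solve; _:*_; _:-_; :-_; con; _:=_)

module _ {p} {P : Pred ℕ p} (P? : Decidable P) where

  minimal-witness : ∀ {n} → P n → ∃[ m ] (P m × (∀ {t} → t < m → ¬ P t))
  minimal-witness {n} = search n (<-wellFounded n)
    where
    search : ∀ n → Acc _<_ n → P n → ∃[ m ] (P m × (∀ {t} → t < m → ¬ P t))
    search n (acc smaller) pn with ℕP.anyUpTo? P? n
    ... | yes (m , m<n , pm) = search m (smaller m<n) pm
    ... | no none = n , pn , λ t<n pt → none (_ , t<n , pt)

sumℚ-zero : ∀ {g} (f : Fin g → ℚ) → (∀ i → f i ≡ ℚ.0ℚ) → sumℚ f ≡ ℚ.0ℚ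
sumℚ-zero {ℕ.zero} f f≡0 = refl
sumℚ-zero {suc g}  f f≡0 =
  trans (cong₂ ℚ._+_ (f≡0 zero) (sumℚ-zero (f ∘ suc) (f≡0 ∘ suc))) (ℚP.+-identityʳ ℚ.0ℚ)

sumℚ-single : ∀ {g} (f : Fin g → ℚ) i → (∀ j → j ≢ i → f j ≡ ℚ.0ℚ) → sumℚ f ≡ f i
sumℚ-single f zero    off =
  trans (cong (f zero ℚ.+_) (sumℚ-zero (f ∘ suc) (λ j → off (suc j) λ ()))) (ℚP.+-identityʳ (f zero))
sumℚ-single f (suc i) off =
  trans (cong (ℚ._+ sumℚ (f ∘ suc)) (off zero λ ()))
        (trans (ℚP.+-identityˡ _) (sumℚ-single (f ∘ suc) i λ j j≢i → off (suc j) (j≢i ∘ FinP.suc-injective)))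

sumℤ-zero : ∀ {g} (f : Fin g → ℤ) → (∀ i → f i ≡ + 0) → sumℤ f ≡ + 0
sumℤ-zero {ℕ.zero} f f≡0 = refl
sumℤ-zero {suc g}  f f≡0 = cong₂ ℤ._+_ (f≡0 zero) (sumℤ-zero (f ∘ suc) (f≡0 ∘ suc))

sumℤ-∣ : ∀ {g k} (f : Fin g → ℤ) → (∀ i → k ∣ f i) → k ∣ sumℤ f
sumℤ-∣ {ℕ.zero} {k} f _ = divides (+ 0) (sym (ℤP.*-zeroˡ k))
sumℤ-∣ {suc g}      f k∣f = ∣m∣n⇒∣m+n (k∣f zero) (sumℤ-∣ (f ∘ suc) (k∣f ∘ suc))

ιℤ-toℚᵘ : ∀ a → ℚ.toℚᵘ (ιℤ a) ℚᵘ.≃ ℚᵘ.mkℚᵘ a 0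
ιℤ-toℚᵘ a = ℚP.toℚᵘ-fromℚᵘ (ℚᵘ.mkℚᵘ a 0)

toℚᵘ≃⇒≡ιℤ : ∀ {p} a → ℚ.toℚᵘ p ℚᵘ.≃ ℚᵘ.mkℚᵘ a 0 → p ≡ ιℤ a
toℚᵘ≃⇒≡ιℤ {p} a eq = trans (sym (ℚP.fromℚᵘ-toℚᵘ p)) (ℚP.fromℚᵘ-cong eq)

ιℤ-homo-+ : ∀ a b → ιℤ (a ℤ.+ b) ≡ ιℤ a ℚ.+ ιℤ b
ιℤ-homo-+ a b = sym (toℚᵘ≃⇒≡ιℤ (a ℤ.+ b) (begin
  ℚ.toℚᵘ (ιℤ a ℚ.+ ιℤ b)                   ≈⟨ ℚP.toℚᵘ-homo-+ (ιℤ a) (ιℤ b) ⟩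
  ℚ.toℚᵘ (ιℤ a) ℚᵘ.+ ℚ.toℚᵘ (ιℤ b)         ≈⟨ ℚᵘP.+-cong (ιℤ-toℚᵘ a) (ιℤ-toℚᵘ b) ⟩
  ℚᵘ.mkℚᵘ a 0 ℚᵘ.+ ℚᵘ.mkℚᵘ b 0             ≈⟨ ℚᵘ.*≡* (over-one a b) ⟩
  ℚᵘ.mkℚᵘ (a ℤ.+ b) 0                      ∎))
  where
  open ℚᵘP.≃-Reasoning
  over-one : ∀ a b → (a ℤ.* + 1 ℤ.+ b ℤ.* + 1) ℤ.* + 1 ≡ (a ℤ.+ b) ℤ.* + 1
  over-one = solve-∀

ιℤ-homo-* : ∀ a b → ιℤ (a ℤ.* b) ≡ ιℤ a ℚ.* ιℤ b
ιℤ-homo-* a b = sym (toℚᵘ≃⇒≡ιℤ (a ℤ.* b) (begin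
  ℚ.toℚᵘ (ιℤ a ℚ.* ιℤ b)                   ≈⟨ ℚP.toℚᵘ-homo-* (ιℤ a) (ιℤ b) ⟩
  ℚ.toℚᵘ (ιℤ a) ℚᵘ.* ℚ.toℚᵘ (ιℤ b)         ≈⟨ ℚᵘP.*-cong (ιℤ-toℚᵘ a) (ιℤ-toℚᵘ b) ⟩
  ℚᵘ.mkℚᵘ (a ℤ.* b) 0                      ∎))
  where open ℚᵘP.≃-Reasoning

ιℤ-homo‿- : ∀ a → ιℤ (ℤ.- a) ≡ ℚ.- ιℤ a
ιℤ-homo‿- a = sym (toℚᵘ≃⇒≡ιℤ (ℤ.- a) (begin
  ℚ.toℚᵘ (ℚ.- ιℤ a)    ≈⟨ ℚP.toℚᵘ-homo‿- (ιℤ a) ⟩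
  ℚᵘ.- ℚ.toℚᵘ (ιℤ a)   ≈⟨ ℚᵘP.-‿cong (ιℤ-toℚᵘ a) ⟩
  ℚᵘ.mkℚᵘ (ℤ.- a) 0    ∎))
  where open ℚᵘP.≃-Reasoning

↥-ιℤ : ∀ a → ↥ ιℤ a ≡ a
↥-ιℤ a = begin
  ↥ ιℤ a                        ≡⟨ ℤP.*-identityʳ (↥ ιℤ a) ⟨
  ↥ ιℤ a ℤ.* + 1                ≡⟨ cong (λ n → ↥ ιℤ a ℤ.* + n) (gcd-zeroʳ ℤ.∣ a ∣) ⟨
  ↥ ιℤ a ℤ.* + gcd ℤ.∣ a ∣ 1    ≡⟨ ℚP.↥-/ a 1 ⟩
  a                             ∎
  where open ≡-Reasoning

ιℤ-injective : ∀ {a b} → ιℤ a ≡ ιℤ b → a ≡ b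
ιℤ-injective {a} {b} eq = trans (sym (↥-ιℤ a)) (trans (cong ↥_ eq) (↥-ιℤ b))

ιℤ-*-/ : ∀ k c → ιℤ (+ suc k) ℚ.* (c / suc k) ≡ ιℤ c
ιℤ-*-/ k c = toℚᵘ≃⇒≡ιℤ c (begin
  ℚ.toℚᵘ (ιℤ (+ suc k) ℚ.* (c / suc k))           ≈⟨ ℚP.toℚᵘ-homo-* (ιℤ (+ suc k)) (c / suc k) ⟩
  ℚ.toℚᵘ (ιℤ (+ suc k)) ℚᵘ.* ℚ.toℚᵘ (c / suc k)   ≈⟨ ℚᵘP.*-cong (ιℤ-toℚᵘ (+ suc k)) (ℚP.toℚᵘ-fromℚᵘ (ℚᵘ.mkℚᵘ c k)) ⟩
  ℚᵘ.mkℚᵘ (+ suc k) 0 ℚᵘ.* ℚᵘ.mkℚᵘ c k            ≈⟨ ℚᵘ.*≡* cross ⟩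
  ℚᵘ.mkℚᵘ c 0                                     ∎)
  where
  open ℚᵘP.≃-Reasoning
  swap : ∀ n c → (n ℤ.* c) ℤ.* + 1 ≡ c ℤ.* n
  swap = solve-∀
  cross : (+ suc k ℤ.* c) ℤ.* + 1 ≡ c ℤ.* + (1 ℕ.* suc k)
  cross = trans (swap (+ suc k) c) (cong (λ m → c ℤ.* + m) (sym (ℕP.*-identityˡ (suc k))))

ιℤ-*-cancelˡ : ∀ k {p q} → ιℤ (+ suc k) ℚ.* p ≡ ιℤ (+ suc k) ℚ.* q → p ≡ q
ιℤ-*-cancelˡ k {p} {q} eq = begin
  p                  ≡⟨ inverse-cancel p ⟨
  n⁻¹ ℚ.* (n ℚ.* p)  ≡⟨ cong (n⁻¹ ℚ.*_) eq ⟩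
  n⁻¹ ℚ.* (n ℚ.* q)  ≡⟨ inverse-cancel q ⟩
  q                  ∎
  where
  open ≡-Reasoning
  n n⁻¹ : ℚ
  n = ιℤ (+ suc k)
  n⁻¹ = + 1 / suc k
  inverse-cancel : ∀ r → n⁻¹ ℚ.* (n ℚ.* r) ≡ r
  inverse-cancel r = begin
    n⁻¹ ℚ.* (n ℚ.* r)  ≡⟨ ℚP.*-assoc n⁻¹ n r ⟨
    (n⁻¹ ℚ.* n) ℚ.* r  ≡⟨ cong (ℚ._* r) (trans (ℚP.*-comm n⁻¹ n) (ιℤ-*-/ k (+ 1))) ⟩
    ℚ.1ℚ ℚ.* r         ≡⟨ ℚP.*-identityˡ r ⟩
    r                  ∎

IsInt-+ : ∀ {p q} → IsInt p → IsInt q → IsInt (p ℚ.+ q)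
IsInt-+ (a , refl) (b , refl) = a ℤ.+ b , sym (ιℤ-homo-+ a b)

IsInt-neg : ∀ {p} → IsInt p → IsInt (ℚ.- p)
IsInt-neg (a , refl) = ℤ.- a , sym (ιℤ-homo‿- a)

IsInt-- : ∀ {p q} → IsInt p → IsInt q → IsInt (p ℚ.- q)
IsInt-- p∈ℤ q∈ℤ = IsInt-+ p∈ℤ (IsInt-neg q∈ℤ)

IsInt? : ∀ q → Dec (IsInt q)
IsInt? q with q ℚP.≟ ιℤ (↥ q)
... | yes q≡ = yes (↥ q , q≡)
... | no q≢ = no λ { (a , refl) → q≢ (cong ιℤ (sym (↥-ιℤ a))) }

-- A record rather than IsInt (ιℤ r ℚ.* y): ℚ arithmetic unfolds eagerly, so r and y
-- could not be inferred from the latter.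
record _∙_∈ℤ (r : ℤ) (y : ℚ) : Set where
  constructor _by_
  field
    numerator    : ℤ
    ιℤ-numerator : ιℤ r ℚ.* y ≡ ιℤ numerator

open _∙_∈ℤ

infix 4 _∙_∈ℤ _∙_∈ℤ² _∙_∈Λ
infix 5 _by_

_∙_∈ℤ² : ℤ → ℚ × ℚ → Set
r ∙ a ∈ℤ² = r ∙ proj₁ a ∈ℤ × r ∙ proj₂ a ∈ℤ

_∙_∈Λ : ∀ {g} → ℤ → LatQ g → Set
r ∙ z ∈Λ = ∀ i → r ∙ z i ∈ℤ²

∙∈ℤ? : ∀ r y → Dec (r ∙ y ∈ℤ)
∙∈ℤ? r y with IsInt? (ιℤ r ℚ.* y)
... | yes (c , r*y≡c) = yes (c by r*y≡c)
... | no r*y∉ℤ        = no λ { (c by r*y≡c) → r*y∉ℤ (c , r*y≡c) }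

∙∈ℤ-+ : ∀ {r s y} → r ∙ y ∈ℤ → s ∙ y ∈ℤ → (r ℤ.+ s) ∙ y ∈ℤ
∙∈ℤ-+ {r} {s} {y} (a by r*y≡a) (b by s*y≡b) = a ℤ.+ b by (begin
  ιℤ (r ℤ.+ s) ℚ.* y               ≡⟨ cong (ℚ._* y) (ιℤ-homo-+ r s) ⟩
  (ιℤ r ℚ.+ ιℤ s) ℚ.* y            ≡⟨ ℚP.*-distribʳ-+ y (ιℤ r) (ιℤ s) ⟩
  ιℤ r ℚ.* y ℚ.+ ιℤ s ℚ.* y        ≡⟨ cong₂ ℚ._+_ r*y≡a s*y≡b ⟩
  ιℤ a ℚ.+ ιℤ b                    ≡⟨ ιℤ-homo-+ a b ⟨
  ιℤ (a ℤ.+ b)                     ∎)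
  where open ≡-Reasoning

∙∈ℤ-*ˡ : ∀ a {r y} → r ∙ y ∈ℤ → (a ℤ.* r) ∙ y ∈ℤ
∙∈ℤ-*ˡ a {r} {y} (c by r*y≡c) = a ℤ.* c by (begin
  ιℤ (a ℤ.* r) ℚ.* y               ≡⟨ cong (ℚ._* y) (ιℤ-homo-* a r) ⟩
  (ιℤ a ℚ.* ιℤ r) ℚ.* y            ≡⟨ ℚP.*-assoc (ιℤ a) (ιℤ r) y ⟩
  ιℤ a ℚ.* (ιℤ r ℚ.* y)            ≡⟨ cong (ιℤ a ℚ.*_) r*y≡c ⟩
  ιℤ a ℚ.* ιℤ c                    ≡⟨ ιℤ-homo-* a c ⟨
  ιℤ (a ℤ.* c)                     ∎)
  where open ≡-Reasoning

∙∈ℤ-∣ : ∀ {m n y} → n ℕD.∣ m → (+ n) ∙ y ∈ℤ → (+ m) ∙ y ∈ℤ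
∙∈ℤ-∣ {n = n} {y} (ℕD.divides q refl) n∙y = subst (_∙ y ∈ℤ) (sym (ℤP.pos-* q n)) (∙∈ℤ-*ˡ (+ q) n∙y)

∙∈ℤ-rescale : ∀ {n r y} q (n∙y : (+ n) ∙ y ∈ℤ) → q ℚ.* ιℤ (+ n) ≡ ιℤ r →
              IsInt (q ℚ.* ιℤ (numerator n∙y)) → r ∙ y ∈ℤ
∙∈ℤ-rescale {n} {r} {y} q (c by n*y≡c) q*n≡r (m , q*c≡m) = m by (begin
  ιℤ r ℚ.* y                 ≡⟨ cong (ℚ._* y) q*n≡r ⟨
  (q ℚ.* ιℤ (+ n)) ℚ.* y     ≡⟨ ℚP.*-assoc q (ιℤ (+ n)) y ⟩
  q ℚ.* (ιℤ (+ n) ℚ.* y)     ≡⟨ cong (q ℚ.*_) n*y≡c ⟩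
  q ℚ.* ιℤ c                 ≡⟨ q*c≡m ⟩
  ιℤ m                       ∎)
  where open ≡-Reasoning

1∙∈ℤ⇒IsInt : ∀ {y} → (+ 1) ∙ y ∈ℤ → IsInt y
1∙∈ℤ⇒IsInt {y} (c by 1*y≡c) = c , trans (sym (ℚP.*-identityˡ y)) 1*y≡c

/-numerator : ∀ {k y} (N∙y : (+ suc k) ∙ y ∈ℤ) → numerator N∙y / suc k ≡ y
/-numerator {k} (c by N*y≡c) = ιℤ-*-cancelˡ k (trans (ιℤ-*-/ k c) (sym N*y≡c))

numerator-of-one : ∀ {n} (n∙1 : (+ n) ∙ ℚ.1ℚ ∈ℤ) → numerator n∙1 ≡ + n
numerator-of-one {n} (c by n*1≡c) = ιℤ-injective (trans (sym n*1≡c) (ℚP.*-identityʳ (ιℤ (+ n))))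

∣-numerator : ∀ {n D y} (n∙y : (+ n) ∙ y ∈ℤ) → (+ D) ∙ y ∈ℤ → + n ∣ + D ℤ.* numerator n∙y
∣-numerator {n} {D} {y} (c by n*y≡c) (m by D*y≡m) = divides m (ιℤ-injective (begin
  ιℤ (+ D ℤ.* c)                   ≡⟨ ιℤ-homo-* (+ D) c ⟩
  ιℤ (+ D) ℚ.* ιℤ c                ≡⟨ cong (ιℤ (+ D) ℚ.*_) n*y≡c ⟨
  ιℤ (+ D) ℚ.* (ιℤ (+ n) ℚ.* y)    ≡⟨ rotate (ιℤ (+ D)) (ιℤ (+ n)) y ⟩
  (ιℤ (+ D) ℚ.* y) ℚ.* ιℤ (+ n)    ≡⟨ cong (ℚ._* ιℤ (+ n)) D*y≡m ⟩
  ιℤ m ℚ.* ιℤ (+ n)                ≡⟨ ιℤ-homo-* m (+ n) ⟨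
  ιℤ (m ℤ.* + n)                   ∎))
  where
  open ≡-Reasoning
  rotate : ∀ a b u → a ℚ.* (b ℚ.* u) ≡ (a ℚ.* u) ℚ.* b
  rotate = solve 3 (λ a b u → a :* (b :* u) := (a :* u) :* b) refl

∙∈Λ-+ : ∀ {g r s} {z : LatQ g} → r ∙ z ∈Λ → s ∙ z ∈Λ → (r ℤ.+ s) ∙ z ∈Λ
∙∈Λ-+ r∙z s∙z i = ∙∈ℤ-+ (proj₁ (r∙z i)) (proj₁ (s∙z i)) , ∙∈ℤ-+ (proj₂ (r∙z i)) (proj₂ (s∙z i))

∙∈Λ-*ˡ : ∀ {g r} {z : LatQ g} a → r ∙ z ∈Λ → (a ℤ.* r) ∙ z ∈Λ
∙∈Λ-*ˡ a r∙z i = ∙∈ℤ-*ˡ a (proj₁ (r∙z i)) , ∙∈ℤ-*ˡ a (proj₂ (r∙z i))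

∙∈Λ? : ∀ {g} r (z : LatQ g) → Dec (r ∙ z ∈Λ)
∙∈Λ? r z = FinP.all? λ i → ∙∈ℤ? r (proj₁ (z i)) ×-dec ∙∈ℤ? r (proj₂ (z i))

∙∈Λ-%ℕ : ∀ {g n r} {z : LatQ g} .{{_ : ℕ.NonZero n}} → (+ n) ∙ z ∈Λ → r ∙ z ∈Λ → (+ (r %ℕ n)) ∙ z ∈Λ
∙∈Λ-%ℕ {n = n} {r} {z} n∙z r∙z = subst (_∙ z ∈Λ) (sym remainder) (∙∈Λ-+ r∙z (∙∈Λ-*ˡ (ℤ.- (r /ℕ n)) n∙z))
  where
  move : ∀ t q m → t ≡ (t ℤ.+ q ℤ.* m) ℤ.+ ℤ.- q ℤ.* m
  move = solve-∀
  remainder : + (r %ℕ n) ≡ r ℤ.+ ℤ.- (r /ℕ n) ℤ.* + n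
  remainder = trans (move (+ (r %ℕ n)) (r /ℕ n) (+ n))
                    (cong (λ a → a ℤ.+ ℤ.- (r /ℕ n) ℤ.* + n) (sym (a≡a%ℕn+[a/ℕn]*n r n)))

∃-order : ∀ {g} {z : LatQ g} → ∃[ K ] (+ suc K) ∙ z ∈Λ →
          ∃[ k ] ((+ suc k) ∙ z ∈Λ × (∀ {r} → r ∙ z ∈Λ → + suc k ∣ r))
∃-order {z = z} (K , K∙z) with minimal-witness (λ t → ∙∈Λ? (+ suc t) z) K∙z
... | k , k∙z , below = k , k∙z , generates
  where
  generates : ∀ {r} → r ∙ z ∈Λ → + suc k ∣ r
  generates {r} r∙z =
    by-remainder (r %ℕ suc k) (n%ℕd<d r (suc k)) (∙∈Λ-%ℕ k∙z r∙z) (a≡a%ℕn+[a/ℕn]*n r (suc k))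
    where
    by-remainder : ∀ t → t < suc k → (+ t) ∙ z ∈Λ → r ≡ + t ℤ.+ (r /ℕ suc k) ℤ.* + suc k → + suc k ∣ r
    by-remainder ℕ.zero  _   _   r≡ = divides (r /ℕ suc k) (trans r≡ (ℤP.+-identityˡ _))
    by-remainder (suc t) t<k t∙z _  = ⊥-elim (below (ℕ.s≤s⁻¹ t<k) t∙z)

-- The dual lattice in coordinates

unit : ∀ {g} → Fin g → ℤ × ℤ → Lat g
unit i p = updateAt zeroLat i (const p)

formℚ-unit : ∀ {g} (d : Fin g → ℕ) (y : LatQ g) i a b →
  formℚ d y (embed (unit i (a , b))) ≡ ιℤ (+ d i) ℚ.* (proj₁ (y i) ℚ.* ιℤ b ℚ.- proj₂ (y i) ℚ.* ιℤ a)
formℚ-unit d y i a b =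
  trans (sumℚ-single (λ j → summand j (unit i (a , b) j)) i vanishes)
        (cong (summand i) (updateAt-updates i zeroLat))
  where
  summand : ∀ j → ℤ × ℤ → ℚ
  summand j l = ιℤ (+ d j) ℚ.* (proj₁ (y j) ℚ.* ιℤ (proj₂ l) ℚ.- proj₂ (y j) ℚ.* ιℤ (proj₁ l))
  annihilated : ∀ c u w → c ℚ.* (u ℚ.* ℚ.0ℚ ℚ.- w ℚ.* ℚ.0ℚ) ≡ ℚ.0ℚ
  annihilated = solve 3 (λ c u w → c :* (u :* con ℚ.0ℚ :- w :* con ℚ.0ℚ) := con ℚ.0ℚ) refl
  vanishes : ∀ j → j ≢ i → summand j (unit i (a , b) j) ≡ ℚ.0ℚ
  vanishes j j≢i = trans (cong (summand j) (updateAt-minimal j i zeroLat j≢i))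
                         (annihilated (ιℤ (+ d j)) (proj₁ (y j)) (proj₂ (y j)))

form-unit-f₀ : ∀ {g} (d : Fin (suc g) → ℕ) (v : Lat (suc g)) →
               form d v (unit zero (+ 0 , + 1)) ≡ + d zero ℤ.* proj₁ (v zero)
form-unit-f₀ d v = begin
  form d v (unit zero (+ 0 , + 1))   ≡⟨ cong₂ ℤ._+_ (pick (+ d zero) a b) (sumℤ-zero _ rest≡0) ⟩
  + d zero ℤ.* a ℤ.+ + 0             ≡⟨ ℤP.+-identityʳ _ ⟩
  + d zero ℤ.* a                     ∎
  where
  open ≡-Reasoning
  a b : ℤ
  a = proj₁ (v zero)
  b = proj₂ (v zero)
  pick : ∀ D a b → D ℤ.* (a ℤ.* + 1 ℤ.- b ℤ.* + 0) ≡ D ℤ.* a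
  pick = solve-∀
  annihilated : ∀ D a b → D ℤ.* (a ℤ.* + 0 ℤ.- b ℤ.* + 0) ≡ + 0
  annihilated = solve-∀
  rest≡0 : ∀ i → + d (suc i) ℤ.* (proj₁ (v (suc i)) ℤ.* + 0 ℤ.- proj₂ (v (suc i)) ℤ.* + 0) ≡ + 0
  rest≡0 i = annihilated (+ d (suc i)) (proj₁ (v (suc i))) (proj₂ (v (suc i)))

CoordinatewiseDual : ∀ {g} → (Fin g → ℕ) → LatQ g → Set
CoordinatewiseDual d x = ∀ i → (+ d i) ∙ x i ∈ℤ²

InDual⇒CoordinatewiseDual : ∀ {g} {d : Fin g → ℕ} {x} → InDual d x → CoordinatewiseDual d x
InDual⇒CoordinatewiseDual {d = d} {x} x∨ i = first , second
  where
  open ≡-Reasoning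
  D u w : ℚ
  D = ιℤ (+ d i)
  u = proj₁ (x i)
  w = proj₂ (x i)
  first : (+ d i) ∙ u ∈ℤ
  first with x∨ (unit i (+ 0 , + 1))
  ... | a , pairing≡a = a by (begin
    D ℚ.* u                                        ≡⟨ pick D u w ⟨
    D ℚ.* (u ℚ.* ℚ.1ℚ ℚ.- w ℚ.* ℚ.0ℚ)              ≡⟨ formℚ-unit d x i (+ 0) (+ 1) ⟨
    formℚ d x (embed (unit i (+ 0 , + 1)))         ≡⟨ pairing≡a ⟩
    ιℤ a                                           ∎)
    where
    pick : ∀ c u w → c ℚ.* (u ℚ.* ℚ.1ℚ ℚ.- w ℚ.* ℚ.0ℚ) ≡ c ℚ.* u
    pick = solve 3 (λ c u w → c :* (u :* con ℚ.1ℚ :- w :* con ℚ.0ℚ) := c :* u) refl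
  second : (+ d i) ∙ w ∈ℤ
  second with x∨ (unit i (+ 1 , + 0))
  ... | b , pairing≡b = ℤ.- b by (begin
    D ℚ.* w                                        ≡⟨ pick D u w ⟨
    ℚ.- (D ℚ.* (u ℚ.* ℚ.0ℚ ℚ.- w ℚ.* ℚ.1ℚ))        ≡⟨ cong ℚ.-_ (formℚ-unit d x i (+ 1) (+ 0)) ⟨
    ℚ.- formℚ d x (embed (unit i (+ 1 , + 0)))     ≡⟨ cong ℚ.-_ pairing≡b ⟩
    ℚ.- ιℤ b                                       ≡⟨ ιℤ-homo‿- b ⟨
    ιℤ (ℤ.- b)                                     ∎)
    where
    pick : ∀ c u w → ℚ.- (c ℚ.* (u ℚ.* ℚ.0ℚ ℚ.- w ℚ.* ℚ.1ℚ)) ≡ c ℚ.* w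
    pick = solve 3 (λ c u w → :- (c :* (u :* con ℚ.0ℚ :- w :* con ℚ.1ℚ)) := c :* w) refl

∃-positive-multiple : ∀ {g} {d : Fin g → ℕ} {z} → (∀ i → ℕ.NonZero (d i)) → CoordinatewiseDual d z →
                      ∃[ K ] (+ suc K) ∙ z ∈Λ
∃-positive-multiple {d = d} {z} d≢0 z∨ =
  ℕ.pred ∏d , subst (λ n → (+ n) ∙ z ∈Λ) (sym (ℕP.suc-pred ∏d {{product≢0 (AllP.tabulate⁺ d≢0)}})) ∏d∙z
  where
  ∏d : ℕ
  ∏d = product (tabulate d)
  ∏d∙z : (+ ∏d) ∙ z ∈Λ
  ∏d∙z i = ∙∈ℤ-∣ dᵢ∣∏d (proj₁ (z∨ i)) , ∙∈ℤ-∣ dᵢ∣∏d (proj₂ (z∨ i))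
    where
    dᵢ∣∏d : d i ℕD.∣ ∏d
    dᵢ∣∏d = ∈⇒∣product (∈-tabulate⁺ i)

CoordinatewiseDual-∷ : ∀ {g} {d : Fin (suc g) → ℕ} {x} → CoordinatewiseDual d x →
                       CoordinatewiseDual d ((ℚ.1ℚ , ℚ.0ℚ) ∷ tail x)
CoordinatewiseDual-∷ {d = d} x∨ zero =
  + d zero by ℚP.*-identityʳ (ιℤ (+ d zero)) , + 0 by ℚP.*-zeroʳ (ιℤ (+ d zero))
CoordinatewiseDual-∷ x∨ (suc i) = x∨ (suc i)

SameClass-∷ : ∀ {g} {x : LatQ (suc g)} → (+ 1) ∙ x zero ∈ℤ² → SameClass ((ℚ.1ℚ , ℚ.0ℚ) ∷ tail x) x
SameClass-∷ (u∈ℤ , w∈ℤ) zero = IsInt-- (+ 1 , refl) (1∙∈ℤ⇒IsInt u∈ℤ) , IsInt-- (+ 0 , refl) (1∙∈ℤ⇒IsInt w∈ℤ)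
SameClass-∷ {x = x} _ (suc i) = (+ 0 , ℚP.+-inverseʳ (proj₁ (x (suc i)))) , (+ 0 , ℚP.+-inverseʳ (proj₂ (x (suc i))))

-- The vector v = N y

numerators : ∀ {g r} {z : LatQ g} → r ∙ z ∈Λ → Lat g
numerators r∙z i = numerator (proj₁ (r∙z i)) , numerator (proj₂ (r∙z i))

numerators-∣-form : ∀ {g n} {d : Fin g → ℕ} {z} → CoordinatewiseDual d z → (n∙z : (+ n) ∙ z ∈Λ) →
                    ∀ l → + n ∣ form d (numerators n∙z) l
numerators-∣-form {n = n} {d} z∨ n∙z l = sumℤ-∣ _ λ i →
  subst (+ n ∣_) (sym (expand (+ d i) _ _ (proj₁ (l i)) (proj₂ (l i))))
    (∣m∣n⇒∣m-n (∣m⇒∣m*n (proj₂ (l i)) (∣-numerator (proj₁ (n∙z i)) (proj₁ (z∨ i))))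
               (∣m⇒∣m*n (proj₁ (l i)) (∣-numerator (proj₂ (n∙z i)) (proj₂ (z∨ i)))))
  where
  expand : ∀ D a b u w → D ℤ.* (a ℤ.* w ℤ.- b ℤ.* u) ≡ (D ℤ.* a) ℤ.* w ℤ.- (D ℤ.* b) ℤ.* u
  expand = solve-∀

vstar-numerators : ∀ {g k} {z x : LatQ g} (N∙z : (+ suc k) ∙ z ∈Λ) →
                   SameClass z x → SameClass (vstar (numerators N∙z) k) x
vstar-numerators {x = x} N∙z z≈x i =
  subst (λ a → IsInt (a ℚ.- proj₁ (x i))) (sym (/-numerator (proj₁ (N∙z i)))) (proj₁ (z≈x i)) ,
  subst (λ a → IsInt (a ℚ.- proj₂ (x i))) (sym (/-numerator (proj₂ (N∙z i)))) (proj₂ (z≈x i))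

module _ {g k} {w : LatQ g} (N∙y : (+ suc k) ∙ ((ℚ.1ℚ , ℚ.0ℚ) ∷ w) ∈Λ) where

  numerators-head : proj₁ (numerators N∙y zero) ≡ + suc k
  numerators-head = numerator-of-one (proj₁ (N∙y zero))

  numerators-IsDiv : ∀ {d : Fin (suc g) → ℕ} → d zero ≡ 1 → CoordinatewiseDual d ((ℚ.1ℚ , ℚ.0ℚ) ∷ w) →
                     IsDiv d (numerators N∙y) (suc k)
  numerators-IsDiv {d} d₀≡1 y∨ =
    (λ l → ∣⇒∣ᵤ (numerators-∣-form y∨ N∙y l)) ,
    unit zero (+ 0 , + 1) ,
    trans (form-unit-f₀ d (numerators N∙y))
          (trans (cong₂ (λ a b → + a ℤ.* b) d₀≡1 numerators-head) (ℤP.*-identityˡ (+ suc k)))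

  numerators-Primitive : (∀ {r} → r ∙ ((ℚ.1ℚ , ℚ.0ℚ) ∷ w) ∈Λ → + suc k ∣ r) → Primitive (numerators N∙y)
  numerators-Primitive generates = nonzero , integral
    where
    nonzero : ¬ numerators N∙y ≡ zeroLat
    nonzero v≡0 with trans (sym numerators-head) (cong (λ u → proj₁ (u zero)) v≡0)
    ... | ()
    integral : ∀ q → InLat (scaleℚ q (embed (numerators N∙y))) → IsInt q
    integral q qv∈Λ = m , ιℤ-*-cancelˡ k (begin
      ιℤ (+ suc k) ℚ.* q         ≡⟨ ℚP.*-comm (ιℤ (+ suc k)) q ⟩
      q ℚ.* ιℤ (+ suc k)         ≡⟨ q*N≡r ⟩
      ιℤ r                       ≡⟨ cong ιℤ r≡m*N ⟩
      ιℤ (m ℤ.* + suc k)         ≡⟨ ιℤ-homo-* m (+ suc k) ⟩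
      ιℤ m ℚ.* ιℤ (+ suc k)      ≡⟨ ℚP.*-comm (ιℤ m) (ιℤ (+ suc k)) ⟩
      ιℤ (+ suc k) ℚ.* ιℤ m      ∎)
      where
      open ≡-Reasoning
      q*N∈ℤ : IsInt (q ℚ.* ιℤ (+ suc k))
      q*N∈ℤ = subst (λ c → IsInt (q ℚ.* ιℤ c)) numerators-head (proj₁ (qv∈Λ zero))
      r : ℤ
      r = proj₁ q*N∈ℤ
      q*N≡r : q ℚ.* ιℤ (+ suc k) ≡ ιℤ r
      q*N≡r = proj₂ q*N∈ℤ
      r∙y : r ∙ ((ℚ.1ℚ , ℚ.0ℚ) ∷ w) ∈Λ
      r∙y i = ∙∈ℤ-rescale q (proj₁ (N∙y i)) q*N≡r (proj₁ (qv∈Λ i)) ,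
              ∙∈ℤ-rescale q (proj₂ (N∙y i)) q*N≡r (proj₂ (qv∈Λ i))
      m : ℤ
      m = quotient (generates r∙y)
      r≡m*N : r ≡ m ℤ.* + suc k
      r≡m*N = _∣_.equality (generates r∙y)

proposition2p2 : ∀ (g : ℕ) (d : Fin (suc g) → ℕ) → IsType d → d zero ≡ 1 →
    ∀ (x : LatQ (suc g)) → InDual d x →
    ∃[ v ] ∃[ k ] (Primitive v × IsDiv d v (suc k) ×
      SameClass (vstar v k) x)
proposition2p2 g d (d≢0 , _) d₀≡1 x x∈Λ∨ =
  let k , N∙y , generates = ∃-order (∃-positive-multiple d≢0 y∨) in
  numerators N∙y , k ,
  numerators-Primitive N∙y generates ,
  numerators-IsDiv N∙y d₀≡1 y∨ ,
  vstar-numerators N∙y (SameClass-∷ (subst (λ n → (+ n) ∙ x zero ∈ℤ²) d₀≡1 (x∨ zero)))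
  where
  x∨ : CoordinatewiseDual d x
  x∨ = InDual⇒CoordinatewiseDual x∈Λ∨
  y∨ : CoordinatewiseDual d ((ℚ.1ℚ , ℚ.0ℚ) ∷ tail x)
  y∨ = CoordinatewiseDual-∷ x∨
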